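{- Let $n\ge2$, $m_1$, $m_2$ be positive integers with $\gcd(m_2,n!)=1$, and let $m=m_1m_2$. Let $a\in\mathbb{Z}/m\mathbb{Z}$ and $d=(d_1,\ldots,d_n)\in(\mathbb{Z}/m\mathbb{Z})^n$ be such that $\pi_{m_2}(d_i)$ is invertible in $\mathbb{Z}/m_2\mathbb{Z}$ for all $1\le i\le n$ and $\pi_{m_2}(d_j)-\pi_{m_2}(d_i)$ is invertible in $\mathbb{Z}/m_2\mathbb{Z}$ for all $1\le i<j\le n$. Then for every positive integer $s\equiv -t\pmod{m_2}$ with $t\in[0,n-1]$, the multiplicity function of $\triangle=\mathrm{AS}(a,m_1d,s)$ in $\mathbb{Z}/m\mathbb{Z}$ satisfies $\mathfrak{m}_\triangle(x+m_1)=\mathfrak{m}_\triangle(x)$ for all $x\in\mathbb{Z}/m\mathbb{Z}$.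
   Context: $\pi_{m_2}:\mathbb{Z}/m\mathbb{Z}\to\mathbb{Z}/m_2\mathbb{Z}$ is the canonical projection. $\mathrm{AS}(a,e,s)=\{a+\sum_{u=1}^n l_ue_u: l\in\mathbb{N}^n,\ l_1+\cdots+l_n\le s-1\}$ as a multiset of $\mathbb{Z}/m\mathbb{Z}$, and $m_1d=(m_1d_1,\ldots,m_1d_n)$. $\mathfrak{m}_\triangle(x)$ is the multiplicity of $x$ in $\triangle$. -}

module Defs where

open import Data.Nat as ℕ using (ℕ; zero; suc; _∸_)
open import Data.Nat.Divisibility as ℕD using ()
open import Data.Integer as ℤ using (ℤ; +_; _+_; _-_; _*_; ∣_∣)
open import Data.Integer.Divisibility using (_∣_)
open import Data.List using (List; []; _∷_; map; concatMap; upTo; filter; length)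
open import Data.Vec using (Vec; []; _∷_; lookup)
open import Data.Fin using (Fin)
open import Data.Product using (∃)
open import Relation.Nullary using (Dec)
open import Relation.Binary.PropositionalEquality using (_≡_)

-- Residues of ℤ/kℤ are represented by integers; equality in ℤ/kℤ is congruence.
_≡[mod_]_ : ℤ → ℕ → ℤ → Set
x ≡[mod k ] y = (+ k) ∣ (x - y)

_≡[mod_]?_ : (x : ℤ) (k : ℕ) (y : ℤ) → Dec (x ≡[mod k ] y)
x ≡[mod k ]? y = k ℕD.∣? ∣ x - y ∣

InvertibleMod : ℕ → ℤ → Set
InvertibleMod k r = ∃ λ (y : ℤ) → (r * y) ≡[mod k ] (+ 1)

bounded : (n : ℕ) → ℕ → List (Vec ℕ n)
bounded zero b = [] ∷ []
bounded (suc n) b = concatMap (λ i → map (i ∷_) (bounded n (b ∸ i))) (upTo (suc b))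

lin : {n : ℕ} → Vec ℕ n → Vec ℤ n → ℤ
lin [] [] = + 0
lin (l ∷ ls) (e ∷ es) = (+ l) * e + lin ls es

-- multiplicity of x in the multiset AS(a,e,s) ⊆ ℤ/mℤ
-- AS(a,e,s) = { a + Σ l_u e_u : l ∈ ℕⁿ, l₁+⋯+lₙ ≤ s-1 }
multAS : (m : ℕ) {n : ℕ} → ℤ → Vec ℤ n → ℕ → ℤ → ℕ
multAS m {n} a e s x =
  length (filter (λ l → (a + lin l e) ≡[mod m ]? x) (bounded n (s ∸ 1)))

scale : {n : ℕ} → ℤ → Vec ℤ n → Vec ℤ n
scale k [] = []
scale k (d ∷ ds) = (k * d) ∷ scale k ds

-- Appending the generator 0 to d turns AS(a, d, s) into the layer
-- {a + Σ lᵤFᵤ : l₁ + ⋯ + lₙ₊₁ = s − 1} of F = (d, 0), and modulo m₁m₂ the multiset AS(a, m₁d, s) is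
-- AS(0, d, s) modulo m₂ placed on the residues x ≡ a (mod m₁). So it suffices that the multiplicity
-- N_F(S, ·) of a layer modulo M = m₂ is constant when S + j ≡ 0 (mod M) with 1 ≤ j < |F| (for
-- j = 0: constant up to an extra 1 at 0). This goes by induction on |F|: splitting off l₁ or l₂ gives
--   N_{bF}(S + 1, y) + N_{abF}(S, y − a) = N_{aF}(S + 1, y) + N_{abF}(S, y − b),
-- so by induction N_{abF}(S, ·) has constant increments along b − a, and an M-periodic function
-- with constant increments along a unit modulo M is constant.
module Submission where

open import Defs

module SimplexMultiplicity where

  open import Data.Nat as ℕ using (ℕ; zero; suc; _∸_; NonZero; z≤n; s≤s)
  import Data.Nat.Properties as ℕₚ
  open import Data.Nat.Divisibility using (_∣_; divides)
  open import Data.Nat.ListAction using (sum)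
  open import Data.Integer using (ℤ; +_; -_; _+_; _-_; _*_; 0ℤ)
  import Data.Integer.Properties as ℤₚ
  import Data.Integer.Divisibility as ℤᵤ
  import Data.Integer.Divisibility.Signed as ℤˢ
  open import Data.Integer.DivMod using (_%ℕ_; _/ℕ_; a≡a%ℕn+[a/ℕn]*n)
  open import Data.Integer.Tactic.RingSolver using (solve-∀)
  open import Data.Vec using (Vec; []; _∷_; _∷ʳ_; lookup)
  import Data.Fin as Fin
  open import Data.Vec.Relation.Unary.All using (All; []; _∷_)
  import Data.Vec.Relation.Unary.All.Properties as Allₚ
  open import Data.Vec.Relation.Unary.AllPairs using (AllPairs; []; _∷_)
  open import Data.List
    using (List; []; _∷_; _++_; map; concatMap; filter; length; applyUpTo; upTo)
  open import Data.List.Properties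
    using (filter-++; length-++; filter-≐; filter-none; map-cong; map-upTo)
  import Data.List.Relation.Unary.All as ListAll
  open import Data.Bool using (true; false; if_then_else_)
  open import Data.Product using (∃₂; _,_)
  open import Function using (_∘_; mk⇔)
  open import Relation.Nullary using (¬_; Dec; does; yes; no)
  open import Relation.Nullary.Decidable using (does-⇔)
  open import Relation.Unary using (Pred; Decidable)
  open import Level using (0ℓ)
  open import Relation.Binary.PropositionalEquality
  open import Algebra.Properties.CommutativeSemigroup ℕₚ.+-commutativeSemigroup
    using (interchange; xy∙z≈xz∙y)

  module _ {A : Set} {P : Pred A 0ℓ} (P? : Decidable P) where

    length-filter-singleton : ∀ x → length (filter P? (x ∷ [])) ≡ (if does (P? x) then 1 else 0)
    length-filter-singleton x with does (P? x)
    ... | true  = refl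
    ... | false = refl

    length-filter-map : ∀ {B : Set} (f : B → A) xs →
                        length (filter P? (map f xs)) ≡ length (filter (P? ∘ f) xs)
    length-filter-map f [] = refl
    length-filter-map f (x ∷ xs) with does (P? (f x))
    ... | true  = cong suc (length-filter-map f xs)
    ... | false = length-filter-map f xs

    length-filter-concatMap : ∀ {B : Set} (f : B → List A) xs →
      length (filter P? (concatMap f xs)) ≡ sum (map (λ x → length (filter P? (f x))) xs)
    length-filter-concatMap f [] = refl
    length-filter-concatMap f (x ∷ xs) = begin
      length (filter P? (f x ++ concatMap f xs))
        ≡⟨ cong length (filter-++ P? (f x) (concatMap f xs)) ⟩
      length (filter P? (f x) ++ filter P? (concatMap f xs))
        ≡⟨ length-++ (filter P? (f x)) ⟩
      length (filter P? (f x)) ℕ.+ length (filter P? (concatMap f xs))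
        ≡⟨ cong (length (filter P? (f x)) ℕ.+_) (length-filter-concatMap f xs) ⟩
      length (filter P? (f x)) ℕ.+ sum (map (λ x → length (filter P? (f x))) xs) ∎
      where open ≡-Reasoning

  applyUpTo-cong : ∀ {A : Set} {f g : ℕ → A} → (∀ i → f i ≡ g i) →
                   ∀ n → applyUpTo f n ≡ applyUpTo g n
  applyUpTo-cong f≗g zero    = refl
  applyUpTo-cong f≗g (suc n) = cong₂ _∷_ (f≗g 0) (applyUpTo-cong (f≗g ∘ suc) n)

  module _ {A : Set} where

    all-∷ʳ⁺ : ∀ {P : A → Set} {n} {xs : Vec A n} {y} → All P xs → P y → All P (xs ∷ʳ y)
    all-∷ʳ⁺ []         py = py ∷ []
    all-∷ʳ⁺ (px ∷ pxs) py = px ∷ all-∷ʳ⁺ pxs py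

    module _ {R : A → A → Set} where

      allPairs-∷ʳ⁺ : ∀ {n} {xs : Vec A n} {y} → AllPairs R xs → All (λ x → R x y) xs →
                     AllPairs R (xs ∷ʳ y)
      allPairs-∷ʳ⁺ []         []           = [] ∷ []
      allPairs-∷ʳ⁺ (rx ∷ rxs) (rxy ∷ rxsy) = all-∷ʳ⁺ rx rxy ∷ allPairs-∷ʳ⁺ rxs rxsy

      allPairs-lookup⁻ : ∀ {n} {xs : Vec A n} →
                         (∀ i j → i Fin.< j → R (lookup xs i) (lookup xs j)) → AllPairs R xs
      allPairs-lookup⁻ {xs = []}     _ = []
      allPairs-lookup⁻ {xs = x ∷ xs} r =
        Allₚ.lookup⁻ (λ j → r Fin.zero (Fin.suc j) (s≤s z≤n))
        ∷ allPairs-lookup⁻ (λ i j i<j → r (Fin.suc i) (Fin.suc j) (s≤s i<j))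

  Constant : (ℤ → ℤ) → Set
  Constant f = ∀ y y' → f y ≡ f y'

  vanishing⇒constant : ∀ {f : ℤ → ℤ} → (∀ y → f y ≡ 0ℤ) → Constant f
  vanishing⇒constant f≡0 y y' = trans (f≡0 y) (sym (f≡0 y'))

  p+q≡r+s⇒q-s≡r-p : ∀ {p q r s} → p + q ≡ r + s → q - s ≡ r - p
  p+q≡r+s⇒q-s≡r-p {p} {q} {r} {s} eq = begin
    q - s             ≡⟨ cancelˡ p q s ⟩
    (p + q) - (p + s) ≡⟨ cong (_- (p + s)) eq ⟩
    (r + s) - (p + s) ≡⟨ sym (cancelʳ r p s) ⟩
    r - p             ∎
    where
    open ≡-Reasoning
    cancelˡ : ∀ p q s → q - s ≡ (p + q) - (p + s)
    cancelˡ = solve-∀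
    cancelʳ : ∀ r p s → r - p ≡ (r + s) - (p + s)
    cancelʳ = solve-∀

  progression : ∀ {g : ℤ → ℤ} {δ K} → (∀ w → g (w + δ) ≡ g w + K) →
                ∀ k w → g (w + + k * δ) ≡ g w + + k * K
  progression {g} {δ} {K} step zero w = trans (cong g (unit w δ)) (sym (unit (g w) K))
    where
    unit : ∀ w δ → w + 0ℤ * δ ≡ w
    unit = solve-∀
  progression {g} {δ} {K} step (suc k) w = begin
    g (w + + suc k * δ)       ≡⟨ cong g (split w (+ k) δ) ⟩
    g ((w + + k * δ) + δ)     ≡⟨ step (w + + k * δ) ⟩
    g (w + + k * δ) + K       ≡⟨ cong (_+ K) (progression {g} step k w) ⟩
    (g w + + k * K) + K       ≡⟨ sym (split (g w) (+ k) K) ⟩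
    g w + + suc k * K         ∎
    where
    open ≡-Reasoning
    split : ∀ w k δ → w + (+ 1 + k) * δ ≡ (w + k * δ) + δ
    split = solve-∀

  module _ (M : ℕ) where

    Periodic : {B : Set} → (ℤ → B) → Set
    Periodic g = ∀ y q → g (y + q * + M) ≡ g y

    indicator : ℤ → ℤ → ℕ
    indicator x y = if does (x ≡[mod M ]? y) then 1 else 0

    indicator-cong : ∀ x y x' y' q → x - y ≡ (x' - y') + q * + M →
                     indicator x y ≡ indicator x' y'
    indicator-cong x y x' y' q eq =
      cong (if_then 1 else 0) (does-⇔ (mk⇔ to from) (x ≡[mod M ]? y) (x' ≡[mod M ]? y'))
      where
      M∣qM : + M ℤˢ.∣ (q * + M)
      M∣qM = ℤˢ.∣n⇒∣m*n q ℤˢ.∣-refl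
      to : x ≡[mod M ] y → x' ≡[mod M ] y'
      to p = ℤˢ.∣⇒∣ᵤ (ℤˢ.∣m+n∣n⇒∣m {m = x' - y'}
                        (subst (ℤˢ._∣_ (+ M)) eq (ℤˢ.∣ᵤ⇒∣ p)) M∣qM)
      from : x' ≡[mod M ] y' → x ≡[mod M ] y
      from p = ℤˢ.∣⇒∣ᵤ (subst (ℤˢ._∣_ (+ M)) (sym eq)
                          (ℤˢ.∣m∣n⇒∣m+n (ℤˢ.∣ᵤ⇒∣ {i = x' - y'} p) M∣qM))

    indicator0-periodic : Periodic (indicator 0ℤ)
    indicator0-periodic y q = indicator-cong 0ℤ (y + q * + M) 0ℤ y (- q) (shift y q (+ M))
      where
      shift : ∀ y q m → 0ℤ - (y + q * m) ≡ (0ℤ - y) + (- q) * m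
      shift = solve-∀

    -- multExact F S y counts the l ∈ ℕᵏ with l₁ + ⋯ + lₖ = S and Σ lᵤ Fᵤ ≡ y (mod M);
    -- the last clause splits according to whether l₁ = 0.
    multExact : ∀ {k} → Vec ℤ k → ℕ → ℤ → ℕ
    multExact []      zero    y = indicator 0ℤ y
    multExact []      (suc S) y = 0
    multExact (e ∷ F) zero    y = multExact F zero y
    multExact (e ∷ F) (suc S) y = multExact F (suc S) y ℕ.+ multExact (e ∷ F) S (y - e)

    multExact-zero : ∀ {k} (F : Vec ℤ k) y → multExact F 0 y ≡ indicator 0ℤ y
    multExact-zero []      y = refl
    multExact-zero (e ∷ F) y = multExact-zero F y

    multExact-single : ∀ a S y → multExact (a ∷ []) S y ≡ indicator 0ℤ (y - + S * a)
    multExact-single a zero    y = cong (indicator 0ℤ) (unit y a)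
      where
      unit : ∀ y a → y ≡ y - 0ℤ * a
      unit = solve-∀
    multExact-single a (suc S) y =
      trans (multExact-single a S (y - a)) (cong (indicator 0ℤ) (step y a (+ S)))
      where
      step : ∀ y a i → (y - a) - i * a ≡ y - (+ 1 + i) * a
      step = solve-∀

    multExact-periodic : ∀ {k} (F : Vec ℤ k) S → Periodic (multExact F S)
    multExact-periodic []      zero        = indicator0-periodic
    multExact-periodic []      (suc S) y q = refl
    multExact-periodic (e ∷ F) zero        = multExact-periodic F zero
    multExact-periodic (e ∷ F) (suc S) y q = cong₂ ℕ._+_
      (multExact-periodic F (suc S) y q)
      (trans (cong (multExact (e ∷ F) S) (swap y q e (+ M)))
             (multExact-periodic (e ∷ F) S (y - e) q))
      where
      swap : ∀ y q e m → (y + q * m) - e ≡ (y - e) + q * m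
      swap = solve-∀

    -- The recurrence defining multExact splits off l₁; this is the one splitting off l₂.
    multExact-exchange : ∀ {k} a b (F : Vec ℤ k) S y →
      multExact (a ∷ b ∷ F) (suc S) y
        ≡ multExact (a ∷ F) (suc S) y ℕ.+ multExact (a ∷ b ∷ F) S (y - b)
    multExact-exchange a b F zero y =
      xy∙z≈xz∙y (multExact F 1 y) (multExact F 0 (y - b)) (multExact F 0 (y - a))
    multExact-exchange a b F (suc S) y = begin
      (p ℕ.+ q) ℕ.+ multExact (a ∷ b ∷ F) (suc S) (y - a)
        ≡⟨ cong ((p ℕ.+ q) ℕ.+_) (multExact-exchange a b F S (y - a)) ⟩
      (p ℕ.+ q) ℕ.+ (r ℕ.+ rest ((y - a) - b))
        ≡⟨ interchange p q r (rest ((y - a) - b)) ⟩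
      (p ℕ.+ r) ℕ.+ (q ℕ.+ rest ((y - a) - b))
        ≡⟨ cong (λ z → (p ℕ.+ r) ℕ.+ (q ℕ.+ rest z)) (swap y a b) ⟩
      (p ℕ.+ r) ℕ.+ (q ℕ.+ rest ((y - b) - a)) ∎
      where
      open ≡-Reasoning
      p = multExact F (2 ℕ.+ S) y
      q = multExact (b ∷ F) (suc S) (y - b)
      r = multExact (a ∷ F) (suc S) (y - a)
      rest = multExact (a ∷ b ∷ F) S
      swap : ∀ y a b → (y - a) - b ≡ (y - b) - a
      swap = solve-∀

    multExact-sum : ∀ {k} e (F : Vec ℤ k) S y →
      multExact (e ∷ F) S y ≡ sum (applyUpTo (λ i → multExact F (S ∸ i) (y - + i * e)) (suc S))
    multExact-sum e F zero y =
      trans (cong (multExact F 0) (unit y e)) (sym (ℕₚ.+-identityʳ _))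
      where
      unit : ∀ y e → y ≡ y - 0ℤ * e
      unit = solve-∀
    multExact-sum e F (suc S) y = cong₂ ℕ._+_
      (cong (multExact F (suc S)) (unit y e))
      (trans (multExact-sum e F S (y - e))
             (cong sum (applyUpTo-cong (λ i → cong (multExact F (S ∸ i)) (step y e (+ i)))
                                       (suc S))))
      where
      unit : ∀ y e → y ≡ y - 0ℤ * e
      unit = solve-∀
      step : ∀ y e i → (y - e) - i * e ≡ y - (+ 1 + i) * e
      step = solve-∀

    multAS-multExact : ∀ {n} a (d : Vec ℤ n) S y →
                       multAS M a d (suc S) y ≡ multExact (d ∷ʳ 0ℤ) S (y - a)
    multAS-multExact a [] S y = begin
      length (filter (λ l → (a + lin l []) ≡[mod M ]? y) ([] ∷ []))
        ≡⟨ length-filter-singleton (λ l → (a + lin l []) ≡[mod M ]? y) [] ⟩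
      indicator (a + 0ℤ) y
        ≡⟨ indicator-cong (a + 0ℤ) y 0ℤ ((y - a) - + S * 0ℤ) 0ℤ
                          (rearrange a y (+ S) (+ M)) ⟩
      indicator 0ℤ ((y - a) - + S * 0ℤ)
        ≡⟨ sym (multExact-single 0ℤ S (y - a)) ⟩
      multExact (0ℤ ∷ []) S (y - a) ∎
      where
      open ≡-Reasoning
      rearrange : ∀ a y s m → (a + 0ℤ) - y ≡ (0ℤ - ((y - a) - s * 0ℤ)) + 0ℤ * m
      rearrange = solve-∀
    multAS-multExact {suc n} a (e ∷ d) S y = begin
      length (filter P? (concatMap layer (upTo (suc S))))
        ≡⟨ length-filter-concatMap P? layer (upTo (suc S)) ⟩
      sum (map (λ i → length (filter P? (layer i))) (upTo (suc S)))
        ≡⟨ cong sum (map-cong count-layer (upTo (suc S))) ⟩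
      sum (map (λ i → multExact (d ∷ʳ 0ℤ) (S ∸ i) ((y - a) - + i * e)) (upTo (suc S)))
        ≡⟨ cong sum (map-upTo _ (suc S)) ⟩
      sum (applyUpTo (λ i → multExact (d ∷ʳ 0ℤ) (S ∸ i) ((y - a) - + i * e)) (suc S))
        ≡⟨ sym (multExact-sum e (d ∷ʳ 0ℤ) S (y - a)) ⟩
      multExact (e ∷ (d ∷ʳ 0ℤ)) S (y - a) ∎
      where
      open ≡-Reasoning
      P? = λ (l : Vec ℕ (suc n)) → (a + lin l (e ∷ d)) ≡[mod M ]? y
      layer = λ i → map (i ∷_) (bounded n (S ∸ i))
      regroup : ∀ i l → a + lin (i ∷ l) (e ∷ d) ≡ (a + + i * e) + lin l d
      regroup i l = sym (ℤₚ.+-assoc a (+ i * e) (lin l d))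
      shift : ∀ y a i e → y - (a + i * e) ≡ (y - a) - i * e
      shift = solve-∀
      count-layer : ∀ i → length (filter P? (layer i))
                          ≡ multExact (d ∷ʳ 0ℤ) (S ∸ i) ((y - a) - + i * e)
      count-layer i = begin
        length (filter P? (layer i))
          ≡⟨ length-filter-map P? (i ∷_) (bounded n (S ∸ i)) ⟩
        length (filter (P? ∘ (i ∷_)) (bounded n (S ∸ i)))
          ≡⟨ cong length (filter-≐ _ _ ( (λ {l} → subst (_≡[mod M ] y) (regroup i l))
                                       , (λ {l} → subst (_≡[mod M ] y) (sym (regroup i l))))
                                       (bounded n (S ∸ i))) ⟩
        multAS M (a + + i * e) d (suc (S ∸ i)) y
          ≡⟨ multAS-multExact (a + + i * e) d (S ∸ i) y ⟩
        multExact (d ∷ʳ 0ℤ) (S ∸ i) (y - (a + + i * e))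
          ≡⟨ cong (multExact (d ∷ʳ 0ℤ) (S ∸ i)) (shift y a (+ i) e) ⟩
        multExact (d ∷ʳ 0ℤ) (S ∸ i) ((y - a) - + i * e) ∎

    Apart : ℤ → ℤ → Set
    Apart x y = InvertibleMod M (y - x)

    invertible-neg : ∀ {r} → InvertibleMod M r → InvertibleMod M (0ℤ - r)
    invertible-neg {r} (u , ru≡1) = - u , subst (_≡[mod M ] (+ 1)) (negate r u) ru≡1
      where
      negate : ∀ r u → r * u ≡ (0ℤ - r) * - u
      negate = solve-∀

    spike : ℕ → ℤ → ℤ
    spike zero    y = + indicator 0ℤ y
    spike (suc j) y = 0ℤ

    Flat : ℕ → (ℤ → ℕ) → Set
    Flat j f = Constant (λ y → + f y - spike j y)

    multExact-flat-recurrence : ∀ {k} a (F : Vec ℤ k) S →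
      Flat 0 (multExact F (suc S)) → Flat 1 (multExact (a ∷ F) S) →
      Flat 0 (multExact (a ∷ F) (suc S))
    multExact-flat-recurrence a F S F-flat layer-flat y y' = begin
      + multExact (a ∷ F) (suc S) y - + indicator 0ℤ y
        ≡⟨ split y ⟩
      (+ multExact F (suc S) y - + indicator 0ℤ y) + (+ multExact (a ∷ F) S (y - a) - 0ℤ)
        ≡⟨ cong₂ _+_ (F-flat y y') (layer-flat (y - a) (y' - a)) ⟩
      (+ multExact F (suc S) y' - + indicator 0ℤ y') + (+ multExact (a ∷ F) S (y' - a) - 0ℤ)
        ≡⟨ sym (split y') ⟩
      + multExact (a ∷ F) (suc S) y' - + indicator 0ℤ y' ∎
      where
      open ≡-Reasoning
      regroup : ∀ p q i → (p + q) - i ≡ (p - i) + (q - 0ℤ)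
      regroup = solve-∀
      split : ∀ y → + multExact (a ∷ F) (suc S) y - + indicator 0ℤ y
                    ≡ (+ multExact F (suc S) y - + indicator 0ℤ y)
                      + (+ multExact (a ∷ F) S (y - a) - 0ℤ)
      split y = trans (cong (_- + indicator 0ℤ y) (ℤₚ.pos-+ (multExact F (suc S) y) _))
                      (regroup (+ multExact F (suc S) y) (+ multExact (a ∷ F) S (y - a))
                               (+ indicator 0ℤ y))

    module _ .{{_ : NonZero M}} where

      -- With δu ≡ 1 (mod M), the step count is a natural representative of (y' − y)u.
      unit-reaches : ∀ {δ} → InvertibleMod M δ →
                     ∀ y y' → ∃₂ λ (k : ℕ) q → y + + k * δ ≡ y' + q * + M
      unit-reaches {δ} (u , δu≡1) y y' = k , (y' - y) * c - r * δ , (begin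
        y + + k * δ
          ≡⟨ cong (λ t → y + t * δ) k≡z-rM ⟩
        y + (z - r * + M) * δ
          ≡⟨ expand y y' δ u r (+ M) ⟩
        y + (y' - y) * (δ * u - + 1) + (y' - y) - r * δ * + M
          ≡⟨ cong (λ t → y + (y' - y) * t + (y' - y) - r * δ * + M) δu-1≡cM ⟩
        y + (y' - y) * (c * + M) + (y' - y) - r * δ * + M
          ≡⟨ collect y y' δ c r (+ M) ⟩
        y' + ((y' - y) * c - r * δ) * + M ∎)
        where
        open ≡-Reasoning
        z = (y' - y) * u
        k = z %ℕ M
        r = z /ℕ M
        M∣δu-1 : + M ℤˢ.∣ (δ * u - + 1)
        M∣δu-1 = ℤˢ.∣ᵤ⇒∣ δu≡1
        c = ℤˢ._∣_.quotient M∣δu-1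
        δu-1≡cM : δ * u - + 1 ≡ c * + M
        δu-1≡cM = ℤˢ._∣_.equality M∣δu-1
        cancel : ∀ k q → k ≡ (k + q) - q
        cancel = solve-∀
        k≡z-rM : + k ≡ z - r * + M
        k≡z-rM = trans (cancel (+ k) (r * + M)) (cong (_- r * + M) (sym (a≡a%ℕn+[a/ℕn]*n z M)))
        expand : ∀ y y' δ u r m → y + ((y' - y) * u - r * m) * δ
                                  ≡ y + (y' - y) * (δ * u - + 1) + (y' - y) - r * δ * m
        expand = solve-∀
        collect : ∀ y y' δ c r m → y + (y' - y) * (c * m) + (y' - y) - r * δ * m
                                   ≡ y' + ((y' - y) * c - r * δ) * m
        collect = solve-∀

      -- Iterating the constant increment K around a full period (M steps) gives M·K = 0.
      periodic⇒constant : ∀ {g : ℤ → ℤ} {δ} → Periodic g → InvertibleMod M δ →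
                          Constant (λ w → g (w + δ) - g w) → Constant g
      periodic⇒constant {g} {δ} periodic inv increment y y' with unit-reaches inv y y'
      ... | k , q , reach = begin
        g y                      ≡⟨ sym (invariant k y) ⟩
        g (y + + k * δ)          ≡⟨ cong g reach ⟩
        g (y' + q * + M)         ≡⟨ periodic y' q ⟩
        g y'                     ∎
        where
        open ≡-Reasoning
        K = g (0ℤ + δ) - g 0ℤ
        addback : ∀ x y → x ≡ y + (x - y)
        addback = solve-∀
        step : ∀ w → g (w + δ) ≡ g w + K
        step w = trans (addback (g (w + δ)) (g w)) (cong (λ t → g w + t) (increment w 0ℤ))
        cancel : ∀ x y → y ≡ (x + y) - x
        cancel = solve-∀
        M*K≡0 : + M * K ≡ 0ℤ
        M*K≡0 = begin
          + M * K                  ≡⟨ cancel (g 0ℤ) (+ M * K) ⟩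
          (g 0ℤ + + M * K) - g 0ℤ  ≡⟨ cong (_- g 0ℤ) (sym (progression {g} step M 0ℤ)) ⟩
          g (0ℤ + + M * δ) - g 0ℤ  ≡⟨ cong (λ t → g (0ℤ + t) - g 0ℤ) (ℤₚ.*-comm (+ M) δ) ⟩
          g (0ℤ + δ * + M) - g 0ℤ  ≡⟨ cong (_- g 0ℤ) (periodic 0ℤ δ) ⟩
          g 0ℤ - g 0ℤ              ≡⟨ ℤₚ.+-inverseʳ (g 0ℤ) ⟩
          0ℤ                       ∎
        K≡0 : K ≡ 0ℤ
        K≡0 = ℤₚ.*-cancelˡ-≡ (+ M) K 0ℤ (trans M*K≡0 (sym (ℤₚ.*-zeroʳ (+ M))))
        invariant : ∀ k w → g (w + + k * δ) ≡ g w
        invariant k w = begin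
          g (w + + k * δ)          ≡⟨ progression {g} step k w ⟩
          g w + + k * K            ≡⟨ cong (λ t → g w + + k * t) K≡0 ⟩
          g w + + k * 0ℤ           ≡⟨ cong (λ t → g w + t) (ℤₚ.*-zeroʳ (+ k)) ⟩
          g w + 0ℤ                 ≡⟨ ℤₚ.+-identityʳ (g w) ⟩
          g w                      ∎

      multExact-flat-exchange : ∀ {k} a b (F : Vec ℤ k) S j → Apart a b →
        Flat j (multExact (b ∷ F) (suc S)) → Flat j (multExact (a ∷ F) (suc S)) →
        Flat (suc j) (multExact (a ∷ b ∷ F) S)
      multExact-flat-exchange a b F S j a#b withoutA-flat withoutB-flat y y' =
        cong (_- 0ℤ) (periodic⇒constant {g} {b - a} g-periodic a#b increment-constant y y')
        where
        open ≡-Reasoning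
        withoutA withoutB g D : ℤ → ℤ
        withoutA y = + multExact (b ∷ F) (suc S) y
        withoutB y = + multExact (a ∷ F) (suc S) y
        g y = + multExact (a ∷ b ∷ F) S y
        D y = withoutB y - withoutA y
        g-periodic : Periodic g
        g-periodic y q = cong +_ (multExact-periodic (a ∷ b ∷ F) S y q)
        unspike : ∀ p q i → p - q ≡ (p - i) - (q - i)
        unspike = solve-∀
        D-constant : Constant D
        D-constant y y' = begin
          D y
            ≡⟨ unspike (withoutB y) (withoutA y) (spike j y) ⟩
          (withoutB y - spike j y) - (withoutA y - spike j y)
            ≡⟨ cong₂ _-_ (withoutB-flat y y') (withoutA-flat y y') ⟩
          (withoutB y' - spike j y') - (withoutA y' - spike j y')
            ≡⟨ sym (unspike (withoutB y') (withoutA y') (spike j y')) ⟩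
          D y' ∎
        exchange : ∀ y → g (y - a) - g (y - b) ≡ D y
        exchange y = p+q≡r+s⇒q-s≡r-p {withoutA y} {g (y - a)} {withoutB y} {g (y - b)} (begin
          withoutA y + g (y - a)
            ≡⟨ sym (ℤₚ.pos-+ (multExact (b ∷ F) (suc S) y) _) ⟩
          + multExact (a ∷ b ∷ F) (suc S) y
            ≡⟨ cong +_ (multExact-exchange a b F S y) ⟩
          + (multExact (a ∷ F) (suc S) y ℕ.+ multExact (a ∷ b ∷ F) S (y - b))
            ≡⟨ ℤₚ.pos-+ (multExact (a ∷ F) (suc S) y) _ ⟩
          withoutB y + g (y - b) ∎)
        ahead : ∀ w a b → w + (b - a) ≡ (w + b) - a
        ahead = solve-∀
        back : ∀ w b → w ≡ (w + b) - b
        back = solve-∀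
        recentre : ∀ w → g (w + (b - a)) - g w ≡ g ((w + b) - a) - g ((w + b) - b)
        recentre w = cong₂ (λ u v → g u - g v) (ahead w a b) (back w b)
        increment-constant : Constant (λ w → g (w + (b - a)) - g w)
        increment-constant w w' = begin
          g (w + (b - a)) - g w                 ≡⟨ recentre w ⟩
          g ((w + b) - a) - g ((w + b) - b)     ≡⟨ exchange (w + b) ⟩
          D (w + b)                             ≡⟨ D-constant (w + b) (w' + b) ⟩
          D (w' + b)                            ≡⟨ sym (exchange (w' + b)) ⟩
          g ((w' + b) - a) - g ((w' + b) - b)   ≡⟨ sym (recentre w') ⟩
          g (w' + (b - a)) - g w'               ∎

      multExact-flat : ∀ {k} (F : Vec ℤ (suc k)) → AllPairs Apart F →
                       ∀ S j → j ℕ.≤ k → M ∣ S ℕ.+ j → Flat j (multExact F S)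
      multExact-flat (a ∷ []) _ S zero _ (divides c S+0≡cM) = vanishing⇒constant λ y → begin
        + multExact (a ∷ []) S y - + indicator 0ℤ y
          ≡⟨ cong (λ m → + m - + indicator 0ℤ y) (multExact-single a S y) ⟩
        + indicator 0ℤ (y - + S * a) - + indicator 0ℤ y
          ≡⟨ cong (λ z → + indicator 0ℤ z - + indicator 0ℤ y) (full-turns y) ⟩
        + indicator 0ℤ (y + (- (+ c * a)) * + M) - + indicator 0ℤ y
          ≡⟨ cong (λ m → + m - + indicator 0ℤ y) (indicator0-periodic y (- (+ c * a))) ⟩
        + indicator 0ℤ y - + indicator 0ℤ y
          ≡⟨ ℤₚ.+-inverseʳ (+ indicator 0ℤ y) ⟩
        0ℤ ∎
        where
        open ≡-Reasoning
        S≡cM : + S ≡ + c * + M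
        S≡cM = trans (cong +_ (trans (sym (ℕₚ.+-identityʳ S)) S+0≡cM)) (ℤₚ.pos-* c M)
        turns : ∀ y c a m → y - (c * m) * a ≡ y + (- (c * a)) * m
        turns = solve-∀
        full-turns : ∀ y → y - + S * a ≡ y + (- (+ c * a)) * + M
        full-turns y = trans (cong (λ t → y - t * a) S≡cM) (turns y (+ c) a (+ M))
      multExact-flat (a ∷ [])    _ S (suc j) () _
      multExact-flat (a ∷ b ∷ F) _ zero zero _ _ = vanishing⇒constant λ y →
        trans (cong (λ m → + m - + indicator 0ℤ y) (multExact-zero (a ∷ b ∷ F) y))
              (ℤₚ.+-inverseʳ (+ indicator 0ℤ y))
      multExact-flat (a ∷ b ∷ F) apart@(_ ∷ apart-bF) (suc S) zero _ M∣S+1 =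
        multExact-flat-recurrence a (b ∷ F) S
          (multExact-flat (b ∷ F) apart-bF (suc S) zero z≤n M∣S+1)
          (multExact-flat (a ∷ b ∷ F) apart S 1 (s≤s z≤n)
            (subst (M ∣_) (sym (ℕₚ.+-suc S 0)) M∣S+1))
      multExact-flat (a ∷ b ∷ F) ((a#b ∷ a#F) ∷ (b#F ∷ apart-F)) S (suc j) (s≤s j≤k) M∣S+j+1 =
        multExact-flat-exchange a b F S j a#b
          (multExact-flat (b ∷ F) (b#F ∷ apart-F) (suc S) j j≤k M∣S+1+j)
          (multExact-flat (a ∷ F) (a#F ∷ apart-F) (suc S) j j≤k M∣S+1+j)
        where
        M∣S+1+j : M ∣ suc S ℕ.+ j
        M∣S+1+j = subst (M ∣_) (ℕₚ.+-suc S j) M∣S+j+1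

      multAS-constant : ∀ {n} (d : Vec ℤ n) →
        (∀ i → InvertibleMod M (lookup d i)) →
        (∀ i j → i Fin.< j → InvertibleMod M (lookup d j - lookup d i)) →
        ∀ S t → t ℕ.< n → M ∣ suc S ℕ.+ t →
        ∀ a y y' → multAS M a d (suc S) y ≡ multAS M a d (suc S) y'
      multAS-constant d invertible apart S t t<n M∣S+1+t a y y' = begin
        multAS M a d (suc S) y
          ≡⟨ multAS-multExact a d S y ⟩
        multExact (d ∷ʳ 0ℤ) S (y - a)
          ≡⟨ ℤₚ.+-injective (drop-0 (flat (y - a) (y' - a))) ⟩
        multExact (d ∷ʳ 0ℤ) S (y' - a)
          ≡⟨ sym (multAS-multExact a d S y') ⟩
        multAS M a d (suc S) y' ∎
        where
        open ≡-Reasoning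
        apart-d0 : AllPairs Apart (d ∷ʳ 0ℤ)
        apart-d0 = allPairs-∷ʳ⁺ (allPairs-lookup⁻ apart)
                                (Allₚ.lookup⁻ λ i → invertible-neg {lookup d i} (invertible i))
        flat : Flat (suc t) (multExact (d ∷ʳ 0ℤ) S)
        flat = multExact-flat (d ∷ʳ 0ℤ) apart-d0 S (suc t) t<n
                              (subst (M ∣_) (sym (ℕₚ.+-suc S t)) M∣S+1+t)
        drop-0 : ∀ {p q} → p - 0ℤ ≡ q - 0ℤ → p ≡ q
        drop-0 {p} {q} = subst₂ _≡_ (ℤₚ.+-identityʳ p) (ℤₚ.+-identityʳ q)

  lin-scale : ∀ {n} k (l : Vec ℕ n) d → lin l (scale k d) ≡ k * lin l d
  lin-scale k []      []      = sym (ℤₚ.*-zeroʳ k)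
  lin-scale k (i ∷ l) (e ∷ d) = begin
    + i * (k * e) + lin l (scale k d) ≡⟨ cong (λ t → + i * (k * e) + t) (lin-scale k l d) ⟩
    + i * (k * e) + k * lin l d       ≡⟨ distribute (+ i) k e (lin l d) ⟩
    k * (+ i * e + lin l d)           ∎
    where
    open ≡-Reasoning
    distribute : ∀ i k e L → i * (k * e) + k * L ≡ k * (i * e + L)
    distribute = solve-∀

  module _ (k M : ℕ) .{{_ : NonZero k}} {n} (a : ℤ) (d : Vec ℤ n) (s : ℕ) where

    private
      hits : ℤ → Vec ℕ n → Set
      hits x l = (a + lin l (scale (+ k) d)) ≡[mod k ℕ.* M ] x

      hits? : ∀ x l → Dec (hits x l)
      hits? x l = (a + lin l (scale (+ k) d)) ≡[mod k ℕ.* M ]? x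

    multAS-scale-∣ : ∀ x q → x - a ≡ q * + k →
                     multAS (k ℕ.* M) a (scale (+ k) d) s x ≡ multAS M 0ℤ d s q
    multAS-scale-∣ x q x-a≡qk =
      cong length (filter-≐ (hits? x) (λ l → (0ℤ + lin l d) ≡[mod M ]? q)
                            ((λ {l} → to l) , (λ {l} → from l)) (bounded n (s ∸ 1)))
      where
      open ≡-Reasoning
      kM≡k*M : + (k ℕ.* M) ≡ + k * + M
      kM≡k*M = ℤₚ.pos-* k M
      centre : ∀ x a → x ≡ a + (x - a)
      centre = solve-∀
      factor : ∀ a k L q → (a + k * L) - (a + q * k) ≡ k * ((0ℤ + L) - q)
      factor = solve-∀
      difference : ∀ l → (a + lin l (scale (+ k) d)) - x ≡ + k * ((0ℤ + lin l d) - q)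
      difference l = begin
        (a + lin l (scale (+ k) d)) - x
          ≡⟨ cong₂ (λ t u → (a + t) - u) (lin-scale (+ k) l d)
                   (trans (centre x a) (cong (λ t → a + t) x-a≡qk)) ⟩
        (a + + k * lin l d) - (a + q * + k)
          ≡⟨ factor a (+ k) (lin l d) q ⟩
        + k * ((0ℤ + lin l d) - q) ∎
      to : ∀ l → hits x l → (0ℤ + lin l d) ≡[mod M ] q
      to l p = ℤᵤ.*-cancelˡ-∣ (+ k) (subst₂ ℤᵤ._∣_ kM≡k*M (difference l) p)
      from : ∀ l → (0ℤ + lin l d) ≡[mod M ] q → hits x l
      from l p = subst₂ ℤᵤ._∣_ (sym kM≡k*M) (sym (difference l)) (ℤᵤ.*-monoʳ-∣ (+ k) p)

    multAS-scale-∤ : ∀ x → ¬ (+ k ℤˢ.∣ (x - a)) →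
                     multAS (k ℕ.* M) a (scale (+ k) d) s x ≡ 0
    multAS-scale-∤ x k∤x-a =
      cong length (filter-none (hits? x)
                    (ListAll.tabulate {xs = bounded n (s ∸ 1)} (λ {l} _ → misses l)))
      where
      recover : ∀ a L x → L - ((a + L) - x) ≡ x - a
      recover = solve-∀
      k∣kM : + k ℤˢ.∣ + (k ℕ.* M)
      k∣kM = ℤˢ.divides (+ M) (trans (ℤₚ.pos-* k M) (ℤₚ.*-comm (+ k) (+ M)))
      misses : ∀ l → ¬ hits x l
      misses l p =
        k∤x-a (subst (ℤˢ._∣_ (+ k)) (recover a (lin l (scale (+ k) d)) x)
                     (ℤˢ.∣m∣n⇒∣m-n k∣L (ℤˢ.∣-trans k∣kM (ℤˢ.∣ᵤ⇒∣ p))))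
        where
        k∣L : + k ℤˢ.∣ lin l (scale (+ k) d)
        k∣L = ℤˢ.divides (lin l d) (trans (lin-scale (+ k) l d) (ℤₚ.*-comm (+ k) (lin l d)))

    multAS-scale-periodic : (∀ y y' → multAS M 0ℤ d s y ≡ multAS M 0ℤ d s y') →
      ∀ x → multAS (k ℕ.* M) a (scale (+ k) d) s (x + + k)
              ≡ multAS (k ℕ.* M) a (scale (+ k) d) s x
    multAS-scale-periodic constant x with + k ℤˢ.∣? (x - a)
    ... | yes (ℤˢ.divides q x-a≡qk) = begin
      multAS (k ℕ.* M) a (scale (+ k) d) s (x + + k)
        ≡⟨ multAS-scale-∣ (x + + k) (q + + 1) x+k-a≡[q+1]k ⟩
      multAS M 0ℤ d s (q + + 1)
        ≡⟨ constant (q + + 1) q ⟩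
      multAS M 0ℤ d s q
        ≡⟨ sym (multAS-scale-∣ x q x-a≡qk) ⟩
      multAS (k ℕ.* M) a (scale (+ k) d) s x ∎
      where
      open ≡-Reasoning
      regroup : ∀ x a k → (x + k) - a ≡ (x - a) + k
      regroup = solve-∀
      collect : ∀ q k → q * k + k ≡ (q + + 1) * k
      collect = solve-∀
      x+k-a≡[q+1]k : (x + + k) - a ≡ (q + + 1) * + k
      x+k-a≡[q+1]k = trans (regroup x a (+ k)) (trans (cong (_+ + k) x-a≡qk) (collect q (+ k)))
    ... | no k∤x-a = trans (multAS-scale-∤ (x + + k) k∤x+k-a) (sym (multAS-scale-∤ x k∤x-a))
      where
      unshift : ∀ x a k → ((x + k) - a) - k ≡ x - a
      unshift = solve-∀
      k∤x+k-a : ¬ (+ k ℤˢ.∣ ((x + + k) - a))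
      k∤x+k-a k∣ =
        k∤x-a (subst (ℤˢ._∣_ (+ k)) (unshift x a (+ k)) (ℤˢ.∣m∣n⇒∣m-n k∣ ℤˢ.∣-refl))

open SimplexMultiplicity using (multAS-constant; multAS-scale-periodic)

open import Data.Nat using (ℕ; _≤_; _∸_; _+_; _*_; _!; NonZero)
open import Data.Nat.Coprimality using (Coprime)
open import Data.Nat.Divisibility using (_∣_)
open import Data.Integer as ℤ using (ℤ; +_)
open import Data.Vec using (Vec; lookup)
open import Data.Fin using (Fin)
open import Relation.Binary.PropositionalEquality using (_≡_)

open import Data.Nat using (suc; s≤s)

lemma4p2 : (n m₁ m₂ : ℕ) → 2 ≤ n → NonZero m₁ → NonZero m₂ →
    Coprime m₂ (n !) →
    (a : ℤ) (d : Vec ℤ n) →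
    (∀ i → InvertibleMod m₂ (lookup d i)) →
    (∀ i j → Data.Fin._<_ i j → InvertibleMod m₂ (lookup d j ℤ.- lookup d i)) →
    (s t : ℕ) → 1 ≤ s → t ≤ n ∸ 1 → m₂ ∣ (s + t) →
    ∀ (x : ℤ) →
      multAS (m₁ * m₂) a (scale (+ m₁) d) s (x ℤ.+ + m₁)
        ≡ multAS (m₁ * m₂) a (scale (+ m₁) d) s x
lemma4p2 n m₁ m₂ (s≤s (s≤s _)) nz₁ nz₂ _ a d invertible apart (suc S) t _ t≤n∸1 m₂∣s+t =
  multAS-scale-periodic m₁ m₂ {{nz₁}} a d (suc S)
    (multAS-constant m₂ {{nz₂}} d invertible apart S t (s≤s t≤n∸1) m₂∣s+t (+ 0))
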